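{- Let $A_1,\dots,A_k\subseteq[n]$ and let $b_1,\dots,b_k$ be integers. Let $d$ be a non-negative integer such that $d\le\min_{i,j\in[k]}(b_i+b_j-|A_i\cap A_j|)$. Then \[ \mathcal{I} = \{ I\subseteq[n] : |I|\le d \text{ and } |I\cap A_j|\le b_j\ \forall j\in[k]\} \] is the family of independent sets of a matroid. -}

module Defs where

open import Data.Nat using (ℕ; _≤_; _<_)
open import Data.Integer as ℤ using (ℤ; +_; _-_)
open import Data.Fin using (Fin)
open import Data.Fin.Subset using (Subset; ⊥; _⊆_; _∈_; _∉_; _∩_; _∪_; ⁅_⁆; ∣_∣)
open import Data.Product using (_×_; ∃-syntax)

record IsMatroid (n : ℕ) (𝓘 : Subset n → Set) : Set where
  field
    empty-indep : 𝓘 ⊥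
    down-closed : ∀ {I J : Subset n} → J ⊆ I → 𝓘 I → 𝓘 J
    augment     : ∀ {I J : Subset n} → 𝓘 I → 𝓘 J → ∣ I ∣ < ∣ J ∣ →
                  ∃[ x ] (x ∈ J × x ∉ I × 𝓘 (I ∪ ⁅ x ⁆))

BoundedFamily : (n k : ℕ) (A : Fin k → Subset n) (b : Fin k → ℤ) (d : ℕ) →
                Subset n → Set
BoundedFamily n k A b d I = (∣ I ∣ ≤ d) × (∀ j → + ∣ I ∩ A j ∣ ℤ.≤ b j)

module Submission where

-- Write a = |A_j| and b = b_j for one constraint.  Taking i = j
-- in the hypothesis gives  d + a ≤ 2b.  If |I| < d then m = |I ∩ A_j|
-- satisfies m ≤ |I| < d and m ≤ a, hence 2m < d + a ≤ 2b and so m < b: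
-- every set smaller than d satisfies each constraint with room to spare.
-- Consequently adding an arbitrary element to a set of size < d never
-- violates a constraint, and the family is a matroid by a general criterion.

open import Defs
open import Data.Nat using (ℕ)
open import Data.Integer using (ℤ; +_; _+_; _-_; _≤_)
open import Data.Fin using (Fin)
open import Data.Fin.Subset using (Subset; _∩_; ∣_∣)

import Data.Nat as ℕ
import Data.Nat.Properties as ℕP
import Data.Integer as ℤ
import Data.Integer.Properties as ℤP
open import Data.Fin.Properties using (any?)
open import Data.Fin.Subset using (⊥; _⊆_; _∈_; _∉_; _∪_; ⁅_⁆; inside; outside)
open import Data.Fin.Subset.Properties
  using ( _∈?_; p⊆q⇒∣p∣≤∣q∣; ∣p∩q∣≤∣p∣; ∣p∩q∣≤∣q∣; ∣⊥∣≡0; ∣⁅x⁆∣≡1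
        ; x∈p∩q⁺; x∈p∩q⁻; ∩-idem; ∩-distribʳ-∪ )
open import Data.Vec using ([]; _∷_)
open import Data.Product using (_×_; _,_; proj₁; ∃-syntax)
open import Relation.Binary.PropositionalEquality using (_≡_; sym; subst; cong; module ≡-Reasoning)
open import Relation.Nullary using (yes; no; ¬?; contradiction)
open import Relation.Nullary.Decidable using (_×-dec_; decidable-stable)

private
  variable
    n : ℕ

∣p∪q∣≤∣p∣+∣q∣ : (p q : Subset n) → ∣ p ∪ q ∣ ℕ.≤ ∣ p ∣ ℕ.+ ∣ q ∣
∣p∪q∣≤∣p∣+∣q∣ []            []            = ℕ.z≤n
∣p∪q∣≤∣p∣+∣q∣ (inside  ∷ p) (inside  ∷ q) =
  ℕ.s≤s (ℕP.≤-trans (∣p∪q∣≤∣p∣+∣q∣ p q) (ℕP.+-monoʳ-≤ ∣ p ∣ (ℕP.n≤1+n ∣ q ∣)))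
∣p∪q∣≤∣p∣+∣q∣ (inside  ∷ p) (outside ∷ q) = ℕ.s≤s (∣p∪q∣≤∣p∣+∣q∣ p q)
∣p∪q∣≤∣p∣+∣q∣ (outside ∷ p) (inside  ∷ q) =
  subst (ℕ._<_ ∣ p ∪ q ∣) (sym (ℕP.+-suc ∣ p ∣ ∣ q ∣)) (ℕ.s≤s (∣p∪q∣≤∣p∣+∣q∣ p q))
∣p∪q∣≤∣p∣+∣q∣ (outside ∷ p) (outside ∷ q) = ∣p∪q∣≤∣p∣+∣q∣ p q

∣p∪⁅x⁆∣≤1+∣p∣ : (p : Subset n) (x : Fin n) → ∣ p ∪ ⁅ x ⁆ ∣ ℕ.≤ ℕ.suc ∣ p ∣
∣p∪⁅x⁆∣≤1+∣p∣ p x = begin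
  ∣ p ∪ ⁅ x ⁆ ∣          ≤⟨ ∣p∪q∣≤∣p∣+∣q∣ p ⁅ x ⁆ ⟩
  ∣ p ∣ ℕ.+ ∣ ⁅ x ⁆ ∣    ≡⟨ cong (∣ p ∣ ℕ.+_) (∣⁅x⁆∣≡1 x) ⟩
  ∣ p ∣ ℕ.+ 1            ≡⟨ ℕP.+-comm ∣ p ∣ 1 ⟩
  ℕ.suc ∣ p ∣            ∎
  where open ℕP.≤-Reasoning

∣[p∪⁅x⁆]∩q∣≤1+∣p∩q∣ : (p q : Subset n) (x : Fin n) →
                      ∣ (p ∪ ⁅ x ⁆) ∩ q ∣ ℕ.≤ ℕ.suc ∣ p ∩ q ∣
∣[p∪⁅x⁆]∩q∣≤1+∣p∩q∣ p q x = begin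
  ∣ (p ∪ ⁅ x ⁆) ∩ q ∣               ≡⟨ cong ∣_∣ (∩-distribʳ-∪ q p ⁅ x ⁆) ⟩
  ∣ (p ∩ q) ∪ (⁅ x ⁆ ∩ q) ∣         ≤⟨ ∣p∪q∣≤∣p∣+∣q∣ (p ∩ q) (⁅ x ⁆ ∩ q) ⟩
  ∣ p ∩ q ∣ ℕ.+ ∣ ⁅ x ⁆ ∩ q ∣       ≤⟨ ℕP.+-monoʳ-≤ ∣ p ∩ q ∣ (∣p∩q∣≤∣p∣ ⁅ x ⁆ q) ⟩
  ∣ p ∩ q ∣ ℕ.+ ∣ ⁅ x ⁆ ∣           ≡⟨ cong (∣ p ∩ q ∣ ℕ.+_) (∣⁅x⁆∣≡1 x) ⟩
  ∣ p ∩ q ∣ ℕ.+ 1                   ≡⟨ ℕP.+-comm ∣ p ∩ q ∣ 1 ⟩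
  ℕ.suc ∣ p ∩ q ∣                   ∎
  where open ℕP.≤-Reasoning

∩-monoˡ-⊆ : {p q : Subset n} (r : Subset n) → p ⊆ q → p ∩ r ⊆ q ∩ r
∩-monoˡ-⊆ {p = p} r p⊆q x∈p∩r with x∈p∩q⁻ p r x∈p∩r
... | x∈p , x∈r = x∈p∩q⁺ (p⊆q x∈p , x∈r)

-- A strictly larger set has an element outside the smaller one; otherwise
-- it would be contained in it (membership is decidable).
larger-has-new-element : {p q : Subset n} → ∣ p ∣ ℕ.< ∣ q ∣ → ∃[ x ] (x ∈ q × x ∉ p)
larger-has-new-element {p = p} {q} ∣p∣<∣q∣ with any? (λ x → (x ∈? q) ×-dec ¬? (x ∈? p))
... | yes new = new
... | no none  = contradiction (p⊆q⇒∣p∣≤∣q∣ q⊆p) (ℕP.<⇒≱ ∣p∣<∣q∣)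
  where
  q⊆p : q ⊆ p
  q⊆p {x} x∈q = decidable-stable (x ∈? p) (λ x∉p → none (x , x∈q , x∉p))

double-reflects-≤ : {i j : ℤ} → i + i ≤ j + j → i ≤ j
double-reflects-≤ {i} {j} 2i≤2j with i ℤ.≤? j
... | yes i≤j = i≤j
... | no  i≰j = contradiction 2i≤2j (ℤP.<⇒≱ (ℤP.+-mono-< j<i j<i))
  where j<i = ℤP.≰⇒> i≰j

double-reflects-< : {i j : ℤ} → i + i ℤ.< j + j → i ℤ.< j
double-reflects-< {i} {j} 2i<2j with i ℤ.<? j
... | yes i<j = i<j
... | no  i≮j = contradiction (ℤP.+-mono-≤ j≤i j≤i) (ℤP.<⇒≱ 2i<2j)
  where j≤i = ℤP.≮⇒≥ i≮j

budget-cover : (d a : ℕ) (b : ℤ) → + d ≤ (b + b) - + a → + d + + a ≤ b + b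
budget-cover d a b d≤2b-a = subst (+ d + + a ≤_) cancel (ℤP.+-monoˡ-≤ (+ a) d≤2b-a)
  where
  open ≡-Reasoning
  cancel : (b + b) - + a + + a ≡ b + b
  cancel = begin
    (b + b) - + a + + a        ≡⟨ ℤP.+-assoc (b + b) (ℤ.- + a) (+ a) ⟩
    (b + b) + (ℤ.- + a + + a)  ≡⟨ cong (λ z → (b + b) + z) (ℤP.+-inverseˡ (+ a)) ⟩
    (b + b) + + 0              ≡⟨ ℤP.+-identityʳ (b + b) ⟩
    b + b                      ∎

-- The budget b is non-negative: 0 + 0 ≤ d + a ≤ 2b.
budget-nonneg : (d a : ℕ) (b : ℤ) → + d ≤ (b + b) - + a → + 0 ≤ b
budget-nonneg d a b d≤2b-a =
  double-reflects-≤ (ℤP.≤-trans (ℤ.+≤+ ℕ.z≤n) (budget-cover d a b d≤2b-a))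

-- Slack: a set I with |I| < d meets A in m < b elements, because
-- 2m ≤ |I| + |A| < d + |A| ≤ 2b; so one more element of A still fits.
slack : (d : ℕ) (A : Subset n) (b : ℤ) → + d ≤ (b + b) - + ∣ A ∣ →
        (I : Subset n) → ∣ I ∣ ℕ.< d → + ℕ.suc ∣ I ∩ A ∣ ≤ b
slack d A b d≤2b-a I ∣I∣<d = ℤP.i<j⇒suc[i]≤j (double-reflects-< {+ ∣ I ∩ A ∣} 2m<2b)
  where
  m<d : ∣ I ∩ A ∣ ℕ.< d
  m<d = ℕP.≤-<-trans (∣p∩q∣≤∣p∣ I A) ∣I∣<d

  2m<2b : + ∣ I ∩ A ∣ + + ∣ I ∩ A ∣ ℤ.< b + b
  2m<2b = ℤP.<-≤-trans (ℤP.+-mono-<-≤ (ℤ.+<+ m<d) (ℤ.+≤+ (∣p∩q∣≤∣q∣ I A)))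
                       (budget-cover d ∣ A ∣ b d≤2b-a)

-- Matroid criterion: a down-closed family containing ⊥, whose members have
-- size at most d, and in which every member of size below d can be extended
-- by an arbitrary element, is a matroid.  (Augmentation from I to a larger
-- independent J: |I| < |J| ≤ d, so any element of J outside I will do.)
extendable⇒matroid : (d : ℕ) (𝓘 : Subset n → Set) →
                     𝓘 ⊥ →
                     (∀ {I J} → J ⊆ I → 𝓘 I → 𝓘 J) →
                     (∀ {I} → 𝓘 I → ∣ I ∣ ℕ.≤ d) →
                     (∀ {I} (x : Fin n) → 𝓘 I → ∣ I ∣ ℕ.< d → 𝓘 (I ∪ ⁅ x ⁆)) →
                     IsMatroid n 𝓘
extendable⇒matroid {n} d 𝓘 ⊥∈𝓘 down-closed size≤d extend = record
  { empty-indep = ⊥∈𝓘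
  ; down-closed = down-closed
  ; augment     = augment
  }
  where
  augment : ∀ {I J : Subset n} → 𝓘 I → 𝓘 J → ∣ I ∣ ℕ.< ∣ J ∣ →
            ∃[ x ] (x ∈ J × x ∉ I × 𝓘 (I ∪ ⁅ x ⁆))
  augment I∈𝓘 J∈𝓘 ∣I∣<∣J∣ with larger-has-new-element ∣I∣<∣J∣
  ... | x , x∈J , x∉I = x , x∈J , x∉I , extend x I∈𝓘 (ℕP.<-≤-trans ∣I∣<∣J∣ (size≤d J∈𝓘))

module BoundedFamilyProperties
  (k : ℕ) (A : Fin k → Subset n) (b : Fin k → ℤ) (d : ℕ)
  (budget : ∀ j → + d ≤ (b j + b j) - + ∣ A j ∣)
  where

  𝓘 : Subset n → Set
  𝓘 = BoundedFamily n k A b d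

  bounded-size : ∀ {I : Subset n} → 𝓘 I → ∣ I ∣ ℕ.≤ d
  bounded-size = proj₁

  empty-bounded : 𝓘 ⊥
  empty-bounded = subst (ℕ._≤ d) (sym (∣⊥∣≡0 n)) ℕ.z≤n , ⊥-within
    where
    ⊥-within : ∀ j → + ∣ ⊥ ∩ A j ∣ ≤ b j
    ⊥-within j = ℤP.≤-trans (ℤ.+≤+ (subst (∣ ⊥ ∩ A j ∣ ℕ.≤_) (∣⊥∣≡0 n) (∣p∩q∣≤∣p∣ ⊥ (A j))))
                            (budget-nonneg d ∣ A j ∣ (b j) (budget j))

  bounded-down-closed : ∀ {I J : Subset n} → J ⊆ I → 𝓘 I → 𝓘 J
  bounded-down-closed {I} {J} J⊆I (∣I∣≤d , I-within) =
    ℕP.≤-trans (p⊆q⇒∣p∣≤∣q∣ J⊆I) ∣I∣≤d ,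
    λ j → ℤP.≤-trans (ℤ.+≤+ (p⊆q⇒∣p∣≤∣q∣ (∩-monoˡ-⊆ (A j) J⊆I))) (I-within j)

  -- Extension only uses |I| < d: the slack lemma covers every constraint.
  bounded-extend : ∀ {I : Subset n} (x : Fin n) → 𝓘 I → ∣ I ∣ ℕ.< d → 𝓘 (I ∪ ⁅ x ⁆)
  bounded-extend {I} x _ ∣I∣<d =
    ℕP.≤-trans (∣p∪⁅x⁆∣≤1+∣p∣ I x) ∣I∣<d ,
    λ j → ℤP.≤-trans (ℤ.+≤+ (∣[p∪⁅x⁆]∩q∣≤1+∣p∩q∣ I (A j) x))
                     (slack d (A j) (b j) (budget j) I ∣I∣<d)

  is-matroid : IsMatroid n 𝓘
  is-matroid = extendable⇒matroid d 𝓘 empty-bounded bounded-down-closed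
                                   (λ {I} → bounded-size {I}) (λ {I} → bounded-extend {I})

mainTheorem19 : (n k : ℕ) (A : Fin k → Subset n) (b : Fin k → ℤ) (d : ℕ) →
                (∀ i j → + d ≤ (b i + b j) - + ∣ A i ∩ A j ∣) →
                IsMatroid n (BoundedFamily n k A b d)
mainTheorem19 n k A b d pairwise = BoundedFamilyProperties.is-matroid k A b d budget
  where
  budget : ∀ j → + d ≤ (b j + b j) - + ∣ A j ∣
  budget j = subst (λ Aj → + d ≤ (b j + b j) - + ∣ Aj ∣) (∩-idem (A j)) (pairwise j j)
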